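{- Let $q=p^r$ with $p$ an odd prime, let $k>q+3$, and let $0\leqslant j\leqslant q-2$ be such that the class $C_j$ has exactly two elements. Then the matrix $M_j$ is diagonalizable over $\mathbb{C}_\infty$.
   Context: Let $A=\mathbb{F}_q[t]$, $\mathbb{C}_\infty$ the completion of an algebraic closure of $\mathbb{F}_q((1/t))$. Let $\Gamma_1(t)=\{\gamma\in GL_2(A):\gamma\equiv\left(\begin{smallmatrix}1&*\\0&1\end{smallmatrix}\right)\pmod t\}$ and $S^1_k(\Gamma_1(t))$ the $\mathbb{C}_\infty$-space of Drinfeld cusp forms of weight $k$ for $\Gamma_1(t)$ on the Drinfeld upper half plane, with Atkin operator $U_t(f)(z)=\sum_{\beta\in\mathbb{F}_q}f\big(\frac{z+\beta}{t}\big)$ (up to a nonzero normalizing scalar). Via Teitelbaum's isomorphism with harmonic cocycles, $S^1_k(\Gamma_1(t))$ has a basis $c_0,\dots,c_{k-2}$ on which $$U_t(c_j)=-(-t)^{j+1}\binom{k-2-j}{j}c_j-t^{j+1}\sum_{h\neq 0}\left[\binom{k-2-j-h(q-1)}{ -h(q-1)}+(-1)^{j+1}\binom{k-2-j-h(q-1)}{j}\right]c_{j+h(q-1)},$$ with $c_i=0$ for $i\notin[0,k-2]$, binomial coefficients reduced into $\mathbb{F}_p\subset\mathbb{C}_\infty$ and $\binom{n}{m}=0$ if $m<0$ or $m>n$. For $0\leqslant j\leqslant q-2$, $C_j=\{c_\ell:0\leqslant\ell\leqslant k-2,\ \ell\equiv j\pmod{q-1}\}$; its span is $U_t$-stable and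 $M_j$ is the matrix of $U_t$ on it in the basis $C_j$. -}

module Defs where

open import Level using (Level; _⊔_)
open import Data.Nat using (ℕ; zero; suc; _∸_; _≤ᵇ_)
open import Data.Nat.DivMod using (_%_)
open import Data.Nat.Combinatorics using (_C_)
open import Data.Nat.Properties using (_≟_)
open import Data.Bool using (if_then_else_)
open import Data.Fin using (Fin)
import Data.Fin
import Data.Nat
open import Data.List using (List; []; _∷_; filter; upTo; length; lookup)
open import Data.List.Relation.Unary.All using (All)
open import Data.Product using (Σ; _×_; ∃)
open import Relation.Nullary using (¬_)
open import Relation.Binary.PropositionalEquality using (_≡_)
open import Algebra.Bundles using (CommutativeRing)

record Field (c ℓ : Level) : Set (Level.suc (c ⊔ ℓ)) where
  field
    commRing : CommutativeRing c ℓ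
  open CommutativeRing commRing public
  field
    1≉0 : ¬ (1# ≈ 0#)
    inverse : ∀ x → ¬ (x ≈ 0#) → Σ Carrier (λ y → x * y ≈ 1#)

module FieldOps {c ℓ} (K : Field c ℓ) where
  open Field K

  -- image of a natural number in K (so binomials get reduced into F_p)
  fromℕ : ℕ → Carrier
  fromℕ zero = 0#
  fromℕ (suc n) = 1# + fromℕ n

  pow : Carrier → ℕ → Carrier
  pow x zero = 1#
  pow x (suc n) = x * pow x n

  sumFin : ∀ n → (Fin n → Carrier) → Carrier
  sumFin zero f = 0#
  sumFin (suc n) f = f Fin.zero + sumFin n (λ i → f (Fin.suc i))

  evalPoly : List Carrier → Carrier → Carrier
  evalPoly [] x = 0#
  evalPoly (a ∷ as) x = a + x * evalPoly as x

  AlgClosed : Set (c ⊔ ℓ)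
  AlgClosed = ∀ (n : ℕ) (as : Fin (suc n) → Carrier) →
    ∃ λ x → pow x (suc n) + sumFin (suc n) (λ i → as i * pow x (Data.Fin.toℕ i)) ≈ 0#

  HasChar : ℕ → Set ℓ
  HasChar p = fromℕ p ≈ 0#

  Transcendental : Carrier → Set ℓ
  Transcendental t = ∀ (cs : List ℕ) →
    evalPoly (Data.List.map fromℕ cs) t ≈ 0# → All (λ a → fromℕ a ≈ 0#) cs

  Matrix : ℕ → Set c
  Matrix n = Fin n → Fin n → Carrier

  _⊗_ : ∀ {n} → Matrix n → Matrix n → Matrix n
  (A ⊗ B) i j = sumFin _ (λ m → A i m * B m j)

  identity : ∀ {n} → Matrix n
  identity i j = if Data.Fin.toℕ i Data.Nat.≡ᵇ Data.Fin.toℕ j then 1# else 0#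

  diag : ∀ {n} → (Fin n → Carrier) → Matrix n
  diag d i j = if Data.Fin.toℕ i Data.Nat.≡ᵇ Data.Fin.toℕ j then d i else 0#

  _≈M_ : ∀ {n} → Matrix n → Matrix n → Set ℓ
  A ≈M B = ∀ i j → A i j ≈ B i j

  Diagonalizable : ∀ {n} → Matrix n → Set (c ⊔ ℓ)
  Diagonalizable {n} M = Σ (Matrix n) λ P → Σ (Matrix n) λ Q → Σ (Fin n → Carrier) λ d →
    ((P ⊗ Q) ≈M identity) × ((Q ⊗ P) ≈M identity) × (((Q ⊗ M) ⊗ P) ≈M diag d)

  -- Ucoeff t q k a b = coefficient of c_b in U_t(c_a), for a, b in the
  -- same class mod (q-1) and 0 ≤ a, b ≤ k-2.  Writing b = a + h(q-1):
  --   h = 0 :  -(-t)^(a+1) binom(k-2-a, a)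
  --   h ≠ 0 :  -t^(a+1) [binom(k-2-b, a-b) + (-1)^(a+1) binom(k-2-b, a)]
  -- since k-2-a-h(q-1) = k-2-b and -h(q-1) = a-b; binom(n,m) = 0 for
  -- m < 0 (the case b > a) or m > n (stdlib _C_ returns 0 then).
  binomNeg : ℕ → ℕ → ℕ → ℕ
  binomNeg n a b = if b ≤ᵇ a then n C (a ∸ b) else 0

  Ucoeff : Carrier → ℕ → ℕ → ℕ → Carrier
  Ucoeff t k a b with a ≟ b
  ... | Relation.Nullary.yes _ =
        - (pow (- t) (suc a) * fromℕ ((k ∸ 2 ∸ a) C a))
  ... | Relation.Nullary.no _ =
        - (pow t (suc a) * (fromℕ (binomNeg (k ∸ 2 ∸ b) a b)
                            + pow (- 1#) (suc a) * fromℕ ((k ∸ 2 ∸ b) C a)))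

-- the class C_j = { ℓ : 0 ≤ ℓ ≤ k-2, ℓ ≡ j mod (q-1) }, listed increasingly.
-- (q-1 is written  suc (q ∸ 2), which equals q-1 for q ≥ 2.)
Cls : (q k j : ℕ) → List ℕ
Cls q k j = filter (λ ℓ → (ℓ % suc (q ∸ 2)) ≟ (j % suc (q ∸ 2))) (upTo (k ∸ 1))

module _ {c ℓ} (K : Field c ℓ) where
  open Field K
  open FieldOps K

  -- M_j : matrix of U_t on span C_j in the basis C_j;
  -- column m holds the coordinates of U_t(c_{ℓ_m}).
  Mj : Carrier → (q k j : ℕ) → Matrix (length (Cls q k j))
  Mj t q k j row col = Ucoeff t k (lookup (Cls q k j) col) (lookup (Cls q k j) row)

module Submission where

-- Then C_j = {j, b} with b = j + (q - 1), k - 2 = b + e, 0 ≤ e ≤ q - 2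
-- (ResidueClass), and M_j = (A B; C 0) with A = -(-t)^(j+1) α, B = -t^(b+1) β,
-- C = -t^(j+1) γ for α, β, γ in the prime field.  A 2 × 2 matrix with nonzero
-- discriminant and a nonzero off-diagonal entry is diagonalizable (Matrices);
-- here disc = t^(2j+2) (α² + t^(q-1) 4βγ), so by transcendence of t it vanishes
-- only if α = 0 and 4βγ = 0 (Transcendence).  Computing α, β, γ with
-- C(q + x, y) ≡ C(x, y) + C(x, y - q) and C(q - 1, y) ≡ (-1)^y mod p
-- (CharacteristicP), a case analysis on j, e and on which binomial coefficients
-- p divides shows that one of three criteria always applies (TwoElementClass).

open import Defs
open import Level using (Level)
open import Data.Nat as ℕ using (ℕ; zero; suc; _∸_; _≤ᵇ_)
import Data.Nat.Properties as ℕ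
open import Data.Nat.Divisibility as Div using (_∣_; _∣?_; divides)
open import Data.Nat.Primality using (Prime; prime⇒irreducible; prime⇒nonTrivial; prime⇒nonZero; euclidsLemma)
open import Data.Nat.Coprimality using (Coprime; coprime-Bézout)
import Data.Nat.GCD as GCD
open import Data.Integer as ℤ using (ℤ; +_; -[1+_])
import Data.Integer.Properties as ℤ
open import Data.Sign as Sign using (Sign)
open import Data.Bool using (true; false)
import Data.Bool as Bool
open import Data.Unit using (tt)
open import Data.Maybe using (Maybe; just; nothing)
open import Data.Fin using (Fin; zero; suc)
open import Data.List using (List; []; _∷_; _++_; length; lookup; replicate; map)
open import Data.List.Relation.Unary.All using (_∷_)
open import Data.List.Relation.Unary.All.Properties using (++⁻ʳ)
open import Data.Product using (Σ; _,_; _×_; proj₁; proj₂)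
open import Data.Sum using (_⊎_; inj₁; inj₂)
open import Data.Empty using (⊥-elim)
open import Relation.Nullary using (¬_; Dec; yes; no)
open import Relation.Binary.Definitions using (tri<; tri≈; tri>)
open import Relation.Binary.PropositionalEquality as ≡ using (_≡_; _≢_)
import Algebra.Solver.Ring.AlmostCommutativeRing as ACR
import Algebra.Solver.Ring as RingSolver

module Binomials where
  open import Data.Nat
  open import Data.Nat.Properties
  open import Data.Nat.Divisibility
  open import Data.Nat.Combinatorics using (_C_; nCk+nC[k+1]≡[n+1]C[k+1]; nC1≡n; k>n⇒nCk≡0)
  open import Data.Nat.Tactic.RingSolver using (solve-∀)
  open import Relation.Binary.PropositionalEquality

  absorption : ∀ n k → suc k * (suc n C suc k) ≡ suc n * (n C k)
  absorption zero zero = refl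
  absorption zero (suc k) rewrite k>n⇒nCk≡0 {1} {suc (suc k)} (s≤s (s≤s z≤n))
                                | k>n⇒nCk≡0 {0} {suc k} (s≤s z≤n) = *-zeroʳ (suc (suc k))
  absorption (suc n) zero rewrite nC1≡n (suc (suc n)) = trans (*-identityˡ _) (sym (*-identityʳ _))
  absorption (suc n) (suc k) = begin
    suc (suc k) * (suc (suc n) C suc (suc k))   ≡⟨ cong (suc (suc k) *_) (sym (pascal (suc n) (suc k))) ⟩
    suc (suc k) * (X + Y)                       ≡⟨ regroup₁ k X Y ⟩
    suc k * X + suc (suc k) * Y + X             ≡⟨ cong₂ (λ u v → u + v + X) (absorption n k) (absorption n (suc k)) ⟩
    suc n * (n C k) + suc n * (n C suc k) + X   ≡⟨ regroup₂ n (n C k) (n C suc k) X ⟩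
    suc n * (n C k + n C suc k) + X             ≡⟨ cong (λ v → suc n * v + X) (pascal n k) ⟩
    suc n * X + X                               ≡⟨ regroup₃ n X ⟩
    suc (suc n) * X                             ∎
    where
    open ≡-Reasoning
    pascal = nCk+nC[k+1]≡[n+1]C[k+1]
    X = suc n C suc k
    Y = suc n C suc (suc k)
    regroup₁ : ∀ k X Y → suc (suc k) * (X + Y) ≡ suc k * X + suc (suc k) * Y + X
    regroup₁ = solve-∀
    regroup₂ : ∀ n Z W X → suc n * Z + suc n * W + X ≡ suc n * (Z + W) + X
    regroup₂ = solve-∀
    regroup₃ : ∀ n X → suc n * X + X ≡ suc (suc n) * X
    regroup₃ = solve-∀

  primePower∣*-coprime : ∀ {p c} → Prime p → ¬ p ∣ c → ∀ s i → p ^ s ∣ i * c → p ^ s ∣ i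
  primePower∣*-coprime p-prime p∤c zero i _ = 1∣ i
  primePower∣*-coprime {p} {c} p-prime p∤c (suc s) i p^s∣ic
    with euclidsLemma i c p-prime (∣-trans (m∣m*n (p ^ s)) p^s∣ic)
  ... | inj₂ p∣c = ⊥-elim (p∤c p∣c)
  ... | inj₁ (divides i′ refl) = ∣-trans (*-monoʳ-∣ p p^s∣i′) (∣-reflexive (*-comm p i′))
    where
    instance _ = prime⇒nonZero p-prime
    reassoc : ∀ a b d → a * b * d ≡ b * (a * d)
    reassoc = solve-∀
    p^s∣i′ : p ^ s ∣ i′
    p^s∣i′ = primePower∣*-coprime p-prime p∤c s i′ (*-cancelˡ-∣ p (subst (p * p ^ s ∣_) (reassoc i′ p c) p^s∣ic))

  -- The inner binomial coefficients of a prime power q = p^r are divisible by p: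
  -- i·C(q,i) = q·C(q-1,i-1), so if p ∤ C(q,i) then q ∣ i, impossible for 0 < i < q.
  prime∣primePowerBinomial : ∀ {p} r → Prime p → ∀ i → 0 < i → i < p ^ r → p ∣ (p ^ r) C i
  prime∣primePowerBinomial {p} r p-prime (suc i) _ i<q with p ∣? (p ^ r) C suc i
  ... | yes p∣ = p∣
  ... | no p∤ = ⊥-elim (<⇒≱ i<q (∣⇒≤ (primePower∣*-coprime p-prime p∤ r (suc i) q∣)))
    where
    q′ = p ^ r ∸ 1
    suc-q′ : suc q′ ≡ p ^ r
    suc-q′ = trans (+-comm 1 q′) (m∸n+n≡m {p ^ r} {1} (≤-trans (s≤s z≤n) i<q))
    q∣ : p ^ r ∣ suc i * ((p ^ r) C suc i)
    q∣ = subst (λ Q → Q ∣ suc i * (Q C suc i)) suc-q′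
           (divides (q′ C i) (trans (absorption q′ i) (*-comm (suc q′) _)))

  -- Coefficient of X^y in X^q·(1+X)^x, i.e. C(x, y - q), or 0 when y < q.
  shiftedBinom : ℕ → ℕ → ℕ → ℕ
  shiftedBinom q x y with q ≤? y
  ... | yes _ = x C (y ∸ q)
  ... | no _ = 0

  shiftedBinom-< : ∀ q x y → y < q → shiftedBinom q x y ≡ 0
  shiftedBinom-< q x y y<q with q ≤? y
  ... | yes q≤y = ⊥-elim (<⇒≱ y<q q≤y)
  ... | no _ = refl

  shiftedBinom-≥ : ∀ q x y → q ≤ y → shiftedBinom q x y ≡ x C (y ∸ q)
  shiftedBinom-≥ q x y q≤y with q ≤? y
  ... | yes _ = refl
  ... | no q≰y = ⊥-elim (q≰y q≤y)

  shiftedBinom-pascal : ∀ q x y → shiftedBinom q x y + shiftedBinom q x (suc y) ≡ shiftedBinom q (suc x) (suc y)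
  shiftedBinom-pascal q x y with q ≤? y | q ≤? suc y
  ... | yes q≤y | yes _ rewrite +-∸-assoc 1 q≤y = nCk+nC[k+1]≡[n+1]C[k+1] x (y ∸ q)
  ... | yes q≤y | no q≰1+y = ⊥-elim (q≰1+y (≤-trans q≤y (n≤1+n y)))
  ... | no q≰y | yes _ rewrite m≤n⇒m∸n≡0 (≰⇒> q≰y) = refl
  ... | no _ | no _ = refl

open Binomials

-- The residue class of j modulo D = D′ + 1 (with j < D) inside [0, N), listed
-- increasingly; for D′ = q - 2 and N = k - 1 this is the class C_j.
module ResidueClass (D′ j : ℕ) (j≤D′ : j ℕ.≤ D′) where
  open import Data.Nat
  open import Data.Nat.Properties
  open import Data.Nat.DivMod using (_%_; m<n⇒m%n≡m; [m+n]%n≡m%n)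
  open import Data.List using (filter; upTo)
  open import Data.List.Properties using (filter-++; filter-accept; filter-reject; upTo-∷ʳ; length-++; ++-identityʳ)
  open import Relation.Binary.PropositionalEquality

  D : ℕ
  D = suc D′

  InClass : ℕ → Set
  InClass ℓ = ℓ % D ≡ j % D

  inClass? : (ℓ : ℕ) → Dec (InClass ℓ)
  inClass? ℓ = (ℓ % D) ≟ (j % D)

  classBelow : ℕ → List ℕ
  classBelow N = filter inClass? (upTo N)

  b : ℕ
  b = j + D

  j%D≡j : j % D ≡ j
  j%D≡j = m<n⇒m%n≡m (s≤s j≤D′)

  classBelow-suc : ∀ N → classBelow (suc N) ≡ classBelow N ++ filter inClass? (N ∷ [])
  classBelow-suc N = trans (cong (filter inClass?) (sym (upTo-∷ʳ N))) (filter-++ inClass? (upTo N) (N ∷ []))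

  classBelow-member : ∀ N → InClass N → classBelow (suc N) ≡ classBelow N ++ N ∷ []
  classBelow-member N N∈ = trans (classBelow-suc N) (cong (classBelow N ++_) (filter-accept inClass? {N} {[]} N∈))

  classBelow-nonMember : ∀ N → ¬ InClass N → classBelow (suc N) ≡ classBelow N
  classBelow-nonMember N N∉ =
    trans (classBelow-suc N) (trans (cong (classBelow N ++_) (filter-reject inClass? {N} {[]} N∉)) (++-identityʳ _))

  classBelow-gap : ∀ N m → (∀ i → i < m → ¬ InClass (N + i)) → classBelow (N + m) ≡ classBelow N
  classBelow-gap N zero _ = cong classBelow (+-identityʳ N)
  classBelow-gap N (suc m) gap = begin
    classBelow (N + suc m) ≡⟨ cong classBelow (+-suc N m) ⟩
    classBelow (suc (N + m)) ≡⟨ classBelow-nonMember (N + m) (gap m (n<1+n m)) ⟩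
    classBelow (N + m) ≡⟨ classBelow-gap N m (λ i i<m → gap i (m<n⇒m<1+n i<m)) ⟩
    classBelow N ∎
    where open ≡-Reasoning

  length-classBelow-mono : ∀ {N M} → N ≤ M → length (classBelow N) ≤ length (classBelow M)
  length-classBelow-mono {N} {M} N≤M with ≤⇒≤′ N≤M
  ... | ≤′-refl = ≤-refl
  ... | ≤′-step {M′} N≤′M′ = ≤-trans (length-classBelow-mono (≤′⇒≤ N≤′M′)) (begin
    length (classBelow M′) ≤⟨ m≤m+n _ _ ⟩
    length (classBelow M′) + length (filter inClass? (M′ ∷ [])) ≡⟨ sym (length-++ (classBelow M′)) ⟩
    length (classBelow M′ ++ filter inClass? (M′ ∷ [])) ≡⟨ cong length (sym (classBelow-suc M′)) ⟩
    length (classBelow (suc M′)) ∎)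
    where open ≤-Reasoning

  ¬InClass-below-j : ∀ x → x < j → ¬ InClass x
  ¬InClass-below-j x x<j x∈ = <⇒≢ x<j (trans (sym (m<n⇒m%n≡m (<-≤-trans x<j (≤-trans j≤D′ (n≤1+n D′))))) (trans x∈ j%D≡j))

  InClass-unshift : ∀ x → InClass (x + D) → InClass x
  InClass-unshift x x+D∈ = trans (sym ([m+n]%n≡m%n x D)) x+D∈

  ¬InClass-first-gap : ∀ x → j < x → x < j + D → ¬ InClass x
  ¬InClass-first-gap x j<x x<j+D x∈ with x <? D
  ... | yes x<D = <⇒≢ j<x (sym (trans (sym (m<n⇒m%n≡m x<D)) (trans x∈ j%D≡j)))
  ... | no x≮D = ¬InClass-below-j (x ∸ D) y<j (InClass-unshift (x ∸ D) (subst InClass (sym y+D≡x) x∈))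
    where
    y+D≡x : x ∸ D + D ≡ x
    y+D≡x = m∸n+n≡m (≮⇒≥ x≮D)
    y<j : x ∸ D < j
    y<j = +-cancelʳ-< D (x ∸ D) j (subst (_< j + D) (sym y+D≡x) x<j+D)

  ¬InClass-second-gap : ∀ x → b < x → x < b + D → ¬ InClass x
  ¬InClass-second-gap x b<x x<b+D x∈ =
    ¬InClass-first-gap (x ∸ D) j<y y<b (InClass-unshift (x ∸ D) (subst InClass (sym y+D≡x) x∈))
    where
    y+D≡x : x ∸ D + D ≡ x
    y+D≡x = m∸n+n≡m (≤-trans (m≤n+m D j) (<⇒≤ b<x))
    j<y : j < x ∸ D
    j<y = +-cancelʳ-< D j (x ∸ D) (subst (b <_) (sym y+D≡x) b<x)
    y<b : x ∸ D < b
    y<b = +-cancelʳ-< D (x ∸ D) b (subst (_< b + D) (sym y+D≡x) x<b+D)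

  gapBound : ∀ a i → i < D′ → suc a + i < a + D
  gapBound a i i<D′ = subst (suc a + i <_) (sym (+-suc a D′)) (s≤s (subst (_≤ a + D′) (+-suc a i) (+-monoʳ-≤ a i<D′)))

  classBelow-j : classBelow j ≡ []
  classBelow-j = classBelow-gap 0 j ¬InClass-below-j

  classBelow-after-j : ∀ m → m ≤ D′ → classBelow (suc j + m) ≡ j ∷ []
  classBelow-after-j m m≤D′ = trans
    (classBelow-gap (suc j) m (λ i i<m → ¬InClass-first-gap (suc j + i) (s≤s (m≤m+n j i)) (gapBound j i (<-≤-trans i<m m≤D′))))
    (trans (classBelow-member j refl) (cong (_++ j ∷ []) classBelow-j))

  classBelow-b : classBelow b ≡ j ∷ []
  classBelow-b = trans (cong classBelow (+-suc j D′)) (classBelow-after-j D′ ≤-refl)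

  classBelow-after-b : ∀ m → m ≤ D′ → classBelow (suc b + m) ≡ j ∷ b ∷ []
  classBelow-after-b m m≤D′ = trans
    (classBelow-gap (suc b) m (λ i i<m → ¬InClass-second-gap (suc b + i) (s≤s (m≤m+n b i)) (gapBound b i (<-≤-trans i<m m≤D′))))
    (trans (classBelow-member b ([m+n]%n≡m%n j D)) (cong (_++ b ∷ []) classBelow-b))

  length-classBelow-third : length (classBelow (suc (b + D))) ≡ 3
  length-classBelow-third = cong length (trans
    (classBelow-member (b + D) (trans ([m+n]%n≡m%n b D) ([m+n]%n≡m%n j D)))
    (cong (_++ (b + D) ∷ []) (trans (cong classBelow (+-suc b D′)) (classBelow-after-b D′ ≤-refl))))

  twoMembers : ∀ N → length (classBelow N) ≡ 2 →
    Σ ℕ (λ e → e ≤ D′ × N ≡ suc b + e × classBelow N ≡ j ∷ b ∷ [])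
  twoMembers N len with N ≤? b
  ... | yes N≤b = ⊥-elim (<⇒≱ (s≤s ≤-refl) (subst (_≤ 1) len
        (≤-trans (length-classBelow-mono N≤b) (≤-reflexive (cong length classBelow-b)))))
  ... | no N≰b with N ≤? b + D
  ...   | yes N≤b+D = N ∸ suc b , e≤D′ , sym N≡ , trans (cong classBelow (sym N≡)) (classBelow-after-b (N ∸ suc b) e≤D′)
    where
    N≡ : suc b + (N ∸ suc b) ≡ N
    N≡ = m+[n∸m]≡n (≰⇒> N≰b)
    e≤D′ : N ∸ suc b ≤ D′
    e≤D′ = ≤-trans (∸-monoˡ-≤ (suc b) N≤b+D) (≤-reflexive (trans (cong (_∸ suc b) (+-suc b D′)) (m+n∸m≡n (suc b) D′)))
  ...   | no N≰b+D = ⊥-elim (<⇒≱ (s≤s (s≤s (s≤s z≤n))) (subst (3 ≤_) len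
          (≤-trans (≤-reflexive (sym length-classBelow-third)) (length-classBelow-mono (≰⇒> N≰b+D)))))

module FieldLemmas {c ℓ} (K : Field c ℓ) where
  open Field K
  open FieldOps K
  open import Algebra.Properties.Ring ring public
    using (-0#≈0#; -‿involutive; -‿+-comm; -1*x≈-x; +-inverseʳ-unique)
  open import Algebra.Definitions.RawMonoid +-rawMonoid using () renaming (_×_ to _times_)
  open import Algebra.Properties.Monoid.Mult +-monoid using (×-homo-+)
  open import Algebra.Properties.Semiring.Mult semiring using (×1-homo-*)
  open import Relation.Binary.Reasoning.Setoid setoid

  fromℕ-cong : ∀ {m n} → m ≡ n → fromℕ m ≈ fromℕ n
  fromℕ-cong ≡.refl = refl

  fromℕ≡×1 : ∀ n → fromℕ n ≡ n times 1#
  fromℕ≡×1 zero = ≡.refl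
  fromℕ≡×1 (suc n) = ≡.cong (λ x → 1# + x) (fromℕ≡×1 n)

  fromℕ-+ : ∀ m n → fromℕ (m ℕ.+ n) ≈ fromℕ m + fromℕ n
  fromℕ-+ m n rewrite fromℕ≡×1 (m ℕ.+ n) | fromℕ≡×1 m | fromℕ≡×1 n = ×-homo-+ 1# m n

  fromℕ-* : ∀ m n → fromℕ (m ℕ.* n) ≈ fromℕ m * fromℕ n
  fromℕ-* m n rewrite fromℕ≡×1 (m ℕ.* n) | fromℕ≡×1 m | fromℕ≡×1 n = ×1-homo-* m n

  -- The canonical ring morphism ℤ → K; it lets the ring solver work with
  -- integer coefficients.  The clause for +1 makes ι (+ 1) definitionally 1#.
  ι : ℤ → Carrier
  ι (+ zero) = 0#
  ι (+ suc zero) = 1#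
  ι (+ suc (suc n)) = fromℕ (suc (suc n))
  ι -[1+ n ] = - fromℕ (suc n)

  ι-+ℕ : ∀ n → ι (+ n) ≈ fromℕ n
  ι-+ℕ zero = refl
  ι-+ℕ (suc zero) = sym (+-identityʳ 1#)
  ι-+ℕ (suc (suc n)) = refl

  ι-⊖ : ∀ m n → ι (m ℤ.⊖ n) ≈ fromℕ m + - fromℕ n
  ι-⊖ zero zero = sym (trans (+-identityˡ _) -0#≈0#)
  ι-⊖ zero (suc n) = sym (+-identityˡ _)
  ι-⊖ (suc m) zero = trans (ι-+ℕ (suc m)) (sym (trans (+-congˡ -0#≈0#) (+-identityʳ _)))
  ι-⊖ (suc m) (suc n) = begin
    ι (suc m ℤ.⊖ suc n)               ≡⟨ ≡.cong ι (ℤ.[1+m]⊖[1+n]≡m⊖n m n) ⟩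
    ι (m ℤ.⊖ n)                       ≈⟨ ι-⊖ m n ⟩
    fromℕ m + - fromℕ n               ≈⟨ sym (cancel-1 (fromℕ m) (fromℕ n)) ⟩
    fromℕ (suc m) + - fromℕ (suc n)   ∎
    where
    cancel-1 : ∀ x y → (1# + x) + - (1# + y) ≈ x + - y
    cancel-1 x y = begin
      (1# + x) + - (1# + y)      ≈⟨ +-cong (+-comm 1# x) (-‿cong (+-comm 1# y)) ⟩
      (x + 1#) + - (y + 1#)      ≈⟨ +-congˡ (sym (-‿+-comm y 1#)) ⟩
      (x + 1#) + (- y + - 1#)    ≈⟨ +-assoc x 1# _ ⟩
      x + (1# + (- y + - 1#))    ≈⟨ +-congˡ (trans (+-comm 1# _) (+-assoc (- y) (- 1#) 1#)) ⟩
      x + (- y + (- 1# + 1#))    ≈⟨ +-congˡ (+-congˡ (-‿inverseˡ 1#)) ⟩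
      x + (- y + 0#)             ≈⟨ +-congˡ (+-identityʳ (- y)) ⟩
      x + - y                    ∎

  ι-+ : ∀ i j → ι (i ℤ.+ j) ≈ ι i + ι j
  ι-+ (+ m) (+ n) = trans (ι-+ℕ (m ℕ.+ n)) (trans (fromℕ-+ m n) (sym (+-cong (ι-+ℕ m) (ι-+ℕ n))))
  ι-+ (+ m) -[1+ n ] = trans (ι-⊖ m (suc n)) (+-congʳ (sym (ι-+ℕ m)))
  ι-+ -[1+ m ] (+ n) = trans (ι-⊖ n (suc m)) (trans (+-comm _ _) (+-congˡ (sym (ι-+ℕ n))))
  ι-+ -[1+ m ] -[1+ n ] = begin
    - fromℕ (suc (suc (m ℕ.+ n)))           ≈⟨ -‿cong (fromℕ-cong (≡.cong suc (≡.sym (ℕ.+-suc m n)))) ⟩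
    - fromℕ (suc m ℕ.+ suc n)               ≈⟨ -‿cong (fromℕ-+ (suc m) (suc n)) ⟩
    - (fromℕ (suc m) + fromℕ (suc n))       ≈⟨ -‿+-comm _ _ ⟨
    - fromℕ (suc m) + - fromℕ (suc n)       ∎

  ι-neg : ∀ i → ι (ℤ.- i) ≈ - ι i
  ι-neg (+ zero) = sym -0#≈0#
  ι-neg (+ suc n) = -‿cong (sym (ι-+ℕ (suc n)))
  ι-neg -[1+ n ] = trans (ι-+ℕ (suc n)) (sym (-‿involutive _))

  -- write ι i = sign(i)·|i| to prove multiplicativity
  signValue : Sign → Carrier
  signValue Sign.+ = 1#
  signValue Sign.- = - 1#

  signValue-* : ∀ s s′ → signValue (s Sign.* s′) ≈ signValue s * signValue s′
  signValue-* Sign.+ Sign.+ = sym (*-identityˡ 1#)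
  signValue-* Sign.+ Sign.- = sym (*-identityˡ (- 1#))
  signValue-* Sign.- Sign.+ = sym (*-identityʳ (- 1#))
  signValue-* Sign.- Sign.- = sym (trans (-1*x≈-x (- 1#)) (-‿involutive 1#))

  ι-◃ : ∀ s n → ι (s ℤ.◃ n) ≈ signValue s * fromℕ n
  ι-◃ s zero = sym (zeroʳ _)
  ι-◃ Sign.+ (suc n) = trans (ι-+ℕ (suc n)) (sym (*-identityˡ _))
  ι-◃ Sign.- (suc n) = sym (-1*x≈-x _)

  ι-signAbs : ∀ i → ι i ≈ signValue (ℤ.sign i) * fromℕ ℤ.∣ i ∣
  ι-signAbs i = trans (reflexive (≡.cong ι (≡.sym (ℤ.◃-inverse i)))) (ι-◃ (ℤ.sign i) ℤ.∣ i ∣)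

  ι-* : ∀ i j → ι (i ℤ.* j) ≈ ι i * ι j
  ι-* i j = begin
    ι (i ℤ.* j)                                     ≈⟨ ι-◃ (ℤ.sign i Sign.* ℤ.sign j) (ℤ.∣ i ∣ ℕ.* ℤ.∣ j ∣) ⟩
    signValue (ℤ.sign i Sign.* ℤ.sign j) * fromℕ (ℤ.∣ i ∣ ℕ.* ℤ.∣ j ∣)
                                                    ≈⟨ *-cong (signValue-* (ℤ.sign i) (ℤ.sign j)) (fromℕ-* ℤ.∣ i ∣ ℤ.∣ j ∣) ⟩
    (signValue (ℤ.sign i) * signValue (ℤ.sign j)) * (fromℕ ℤ.∣ i ∣ * fromℕ ℤ.∣ j ∣)
                                                    ≈⟨ interchange _ _ _ _ ⟩
    (signValue (ℤ.sign i) * fromℕ ℤ.∣ i ∣) * (signValue (ℤ.sign j) * fromℕ ℤ.∣ j ∣)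
                                                    ≈⟨ *-cong (ι-signAbs i) (ι-signAbs j) ⟨
    ι i * ι j                                       ∎
    where open import Algebra.Properties.CommutativeSemigroup *-commutativeSemigroup using (interchange)

  ℤ⟶K : ℤ.+-*-rawRing ACR.-Raw-AlmostCommutative⟶ ACR.fromCommutativeRing commRing
  ℤ⟶K = record { ⟦_⟧ = ι ; +-homo = ι-+ ; *-homo = ι-* ; -‿homo = ι-neg ; 0-homo = refl ; 1-homo = refl }

  ι-equal? : ∀ i j → Maybe (ι i ≈ ι j)
  ι-equal? i j with i ℤ.≟ j
  ... | yes ≡.refl = just refl
  ... | no _ = nothing

  open RingSolver ℤ.+-*-rawRing (ACR.fromCommutativeRing commRing) ℤ⟶K ι-equal? public
    using (Polynomial; solve; _:=_; _:+_; _:*_; :-_; _:-_; con)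

  cancel-nonzero : ∀ {x y} → ¬ x ≈ 0# → x * y ≈ 0# → y ≈ 0#
  cancel-nonzero {x} {y} x≉0 xy≈0 with inverse x x≉0
  ... | u , xu≈1 = begin
    y             ≈⟨ *-identityʳ y ⟨
    y * 1#        ≈⟨ *-congˡ xu≈1 ⟨
    y * (x * u)   ≈⟨ solve 3 (λ x y u → y :* (x :* u) := u :* (x :* y)) refl x y u ⟩
    u * (x * y)   ≈⟨ *-congˡ xy≈0 ⟩
    u * 0#        ≈⟨ zeroʳ u ⟩
    0#            ∎

  *-nonzero : ∀ {x y} → ¬ x ≈ 0# → ¬ y ≈ 0# → ¬ x * y ≈ 0#
  *-nonzero x≉0 y≉0 xy≈0 = y≉0 (cancel-nonzero x≉0 xy≈0)

  nonzero-resp : ∀ {x y} → x ≈ y → ¬ y ≈ 0# → ¬ x ≈ 0#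
  nonzero-resp x≈y y≉0 x≈0 = y≉0 (trans (sym x≈y) x≈0)

  -‿nonzero : ∀ {x} → ¬ x ≈ 0# → ¬ - x ≈ 0#
  -‿nonzero x≉0 -x≈0 = x≉0 (trans (sym (-‿involutive _)) (trans (-‿cong -x≈0) -0#≈0#))

  -‿zero : ∀ {x} → x ≈ 0# → - x ≈ 0#
  -‿zero x≈0 = trans (-‿cong x≈0) -0#≈0#

  pow-nonzero : ∀ {x} → ¬ x ≈ 0# → ∀ n → ¬ pow x n ≈ 0#
  pow-nonzero x≉0 zero = 1≉0
  pow-nonzero x≉0 (suc n) = *-nonzero x≉0 (pow-nonzero x≉0 n)

  pow-+ : ∀ x m n → pow x (m ℕ.+ n) ≈ pow x m * pow x n
  pow-+ x zero n = sym (*-identityˡ _)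
  pow-+ x (suc m) n = trans (*-congˡ (pow-+ x m n)) (sym (*-assoc _ _ _))

  pow-neg-square : ∀ x n → pow (- x) n * pow (- x) n ≈ pow x n * pow x n
  pow-neg-square x zero = refl
  pow-neg-square x (suc n) = begin
    (- x * pow (- x) n) * (- x * pow (- x) n)   ≈⟨ solve 2 (λ x a → (:- x :* a) :* (:- x :* a) := (x :* x) :* (a :* a)) refl x _ ⟩
    (x * x) * (pow (- x) n * pow (- x) n)       ≈⟨ *-congˡ (pow-neg-square x n) ⟩
    (x * x) * (pow x n * pow x n)               ≈⟨ solve 2 (λ x a → (x :* x) :* (a :* a) := (x :* a) :* (x :* a)) refl x _ ⟩
    (x * pow x n) * (x * pow x n)               ∎

  modulo : ∀ {E T c Z} → Z ≈ 0# → E ≈ T + c * Z → E ≈ T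
  modulo {E} {T} {c} {Z} Z≈0 E≈ = begin
    E         ≈⟨ E≈ ⟩
    T + c * Z ≈⟨ +-congˡ (trans (*-congˡ Z≈0) (zeroʳ c)) ⟩
    T + 0#    ≈⟨ +-identityʳ T ⟩
    T         ∎

  -- The prime subfield, i.e. the image of ℕ (closed under + and ·; under
  -- negation too once the characteristic is positive).
  InPrimeField : Carrier → Set ℓ
  InPrimeField x = Σ ℕ (λ n → x ≈ fromℕ n)

  fromℕ∈ : ∀ n → InPrimeField (fromℕ n)
  fromℕ∈ n = n , refl

  +-∈ : ∀ {x y} → InPrimeField x → InPrimeField y → InPrimeField (x + y)
  +-∈ (m , x≈m) (n , y≈n) = m ℕ.+ n , trans (+-cong x≈m y≈n) (sym (fromℕ-+ m n))

  *-∈ : ∀ {x y} → InPrimeField x → InPrimeField y → InPrimeField (x * y)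
  *-∈ (m , x≈m) (n , y≈n) = m ℕ.* n , trans (*-cong x≈m y≈n) (sym (fromℕ-* m n))

  pow-∈ : ∀ {x} → InPrimeField x → ∀ n → InPrimeField (pow x n)
  pow-∈ x∈ zero = 1 , sym (+-identityʳ 1#)
  pow-∈ x∈ (suc n) = *-∈ x∈ (pow-∈ x∈ n)

module Matrices {c ℓ} (K : Field c ℓ) where
  open Field K hiding (zero)
  open FieldOps K
  open FieldLemmas K
  open import Relation.Binary.Reasoning.Setoid setoid

  sumFin-cong : ∀ n {f g : Fin n → Carrier} → (∀ i → f i ≈ g i) → sumFin n f ≈ sumFin n g
  sumFin-cong zero f≈g = refl
  sumFin-cong (suc n) f≈g = +-cong (f≈g zero) (sumFin-cong n (λ i → f≈g (suc i)))

  sumFin-zero : ∀ n {f : Fin n → Carrier} → (∀ i → f i ≈ 0#) → sumFin n f ≈ 0#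
  sumFin-zero zero f≈0 = refl
  sumFin-zero (suc n) f≈0 = trans (+-cong (f≈0 zero) (sumFin-zero n (λ i → f≈0 (suc i)))) (+-identityʳ 0#)

  sumFin-+ : ∀ n (f g : Fin n → Carrier) → sumFin n (λ i → f i + g i) ≈ sumFin n f + sumFin n g
  sumFin-+ zero f g = sym (+-identityʳ 0#)
  sumFin-+ (suc n) f g = trans (+-congˡ (sumFin-+ n (λ i → f (suc i)) (λ i → g (suc i)))) (interchange _ _ _ _)
    where open import Algebra.Properties.CommutativeSemigroup +-commutativeSemigroup using (interchange)

  sumFin-*ˡ : ∀ n x (f : Fin n → Carrier) → x * sumFin n f ≈ sumFin n (λ i → x * f i)
  sumFin-*ˡ zero x f = zeroʳ x
  sumFin-*ˡ (suc n) x f = trans (distribˡ x _ _) (+-congˡ (sumFin-*ˡ n x (λ i → f (suc i))))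

  sumFin-*ʳ : ∀ n x (f : Fin n → Carrier) → sumFin n f * x ≈ sumFin n (λ i → f i * x)
  sumFin-*ʳ zero x f = zeroˡ x
  sumFin-*ʳ (suc n) x f = trans (distribʳ x _ _) (+-congˡ (sumFin-*ʳ n x (λ i → f (suc i))))

  sumFin-swap : ∀ m n (f : Fin m → Fin n → Carrier) →
    sumFin m (λ i → sumFin n (f i)) ≈ sumFin n (λ j → sumFin m (λ i → f i j))
  sumFin-swap zero n f = sym (sumFin-zero n (λ _ → refl))
  sumFin-swap (suc m) n f = begin
    sumFin n (f zero) + sumFin m (λ i → sumFin n (f (suc i)))
      ≈⟨ +-congˡ (sumFin-swap m n (λ i → f (suc i))) ⟩
    sumFin n (f zero) + sumFin n (λ j → sumFin m (λ i → f (suc i) j))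
      ≈⟨ sumFin-+ n (f zero) (λ j → sumFin m (λ i → f (suc i) j)) ⟨
    sumFin n (λ j → f zero j + sumFin m (λ i → f (suc i) j)) ∎

  ⊗-cong : ∀ {n} {A A′ B B′ : Matrix n} → A ≈M A′ → B ≈M B′ → (A ⊗ B) ≈M (A′ ⊗ B′)
  ⊗-cong {n} A≈ B≈ i j = sumFin-cong n (λ m → *-cong (A≈ i m) (B≈ m j))

  ⊗-assoc : ∀ {n} (A B C : Matrix n) → ((A ⊗ B) ⊗ C) ≈M (A ⊗ (B ⊗ C))
  ⊗-assoc {n} A B C i j = begin
    sumFin n (λ m → sumFin n (λ l → A i l * B l m) * C m j)
      ≈⟨ sumFin-cong n (λ m → sumFin-*ʳ n (C m j) (λ l → A i l * B l m)) ⟩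
    sumFin n (λ m → sumFin n (λ l → A i l * B l m * C m j))
      ≈⟨ sumFin-swap n n (λ m l → A i l * B l m * C m j) ⟩
    sumFin n (λ l → sumFin n (λ m → A i l * B l m * C m j))
      ≈⟨ sumFin-cong n (λ l → trans (sumFin-cong n (λ m → *-assoc _ _ _)) (sym (sumFin-*ˡ n (A i l) (λ m → B l m * C m j)))) ⟩
    sumFin n (λ l → A i l * sumFin n (λ m → B l m * C m j)) ∎

  sumFin-identity : ∀ n (i : Fin n) (v : Fin n → Carrier) → sumFin n (λ m → identity i m * v m) ≈ v i
  sumFin-identity (suc n) zero v = begin
    1# * v zero + sumFin n (λ m → 0# * v (suc m)) ≈⟨ +-cong (*-identityˡ _) (sumFin-zero n (λ m → zeroˡ _)) ⟩
    v zero + 0#                                   ≈⟨ +-identityʳ _ ⟩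
    v zero                                        ∎
  sumFin-identity (suc n) (suc i) v = begin
    0# * v zero + sumFin n (λ m → identity i m * v (suc m)) ≈⟨ +-cong (zeroˡ _) (sumFin-identity n i (λ m → v (suc m))) ⟩
    0# + v (suc i)                                          ≈⟨ +-identityˡ _ ⟩
    v (suc i)                                               ∎

  ⊗-identityˡ : ∀ {n} (A : Matrix n) → (identity ⊗ A) ≈M A
  ⊗-identityˡ {n} A i j = sumFin-identity n i (λ m → A m j)

  eigenbasis⇒diagonalizable : ∀ {n} (M P Q : Matrix n) (d : Fin n → Carrier) →
    (P ⊗ Q) ≈M identity → (Q ⊗ P) ≈M identity → (M ⊗ P) ≈M (P ⊗ diag d) → Diagonalizable M
  eigenbasis⇒diagonalizable M P Q d PQ≈I QP≈I MP≈PD = P , Q , d , PQ≈I , QP≈I , QMP≈D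
    where
    QMP≈D : ((Q ⊗ M) ⊗ P) ≈M diag d
    QMP≈D i j = begin
      ((Q ⊗ M) ⊗ P) i j         ≈⟨ ⊗-assoc Q M P i j ⟩
      (Q ⊗ (M ⊗ P)) i j         ≈⟨ ⊗-cong {A = Q} (λ _ _ → refl) MP≈PD i j ⟩
      (Q ⊗ (P ⊗ diag d)) i j    ≈⟨ ⊗-assoc Q P (diag d) i j ⟨
      ((Q ⊗ P) ⊗ diag d) i j    ≈⟨ ⊗-cong {B = diag d} QP≈I (λ _ _ → refl) i j ⟩
      (identity ⊗ diag d) i j   ≈⟨ ⊗-identityˡ (diag d) i j ⟩
      diag d i j                ∎

  mat₂ : Carrier → Carrier → Carrier → Carrier → Matrix 2
  mat₂ a b c d zero zero = a
  mat₂ a b c d zero (suc zero) = b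
  mat₂ a b c d (suc zero) zero = c
  mat₂ a b c d (suc zero) (suc zero) = d

  vec₂ : Carrier → Carrier → Fin 2 → Carrier
  vec₂ x y zero = x
  vec₂ x y (suc zero) = y

  ⊗₂ : ∀ (X Y : Matrix 2) i j → (X ⊗ Y) i j ≈ X i zero * Y zero j + X i (suc zero) * Y (suc zero) j
  ⊗₂ X Y i j = +-congˡ (+-identityʳ _)

  private
    𝟘 𝟙 -𝟙 : ∀ {n} → Polynomial n
    𝟘 = con (+ 0)
    𝟙 = con (+ 1)
    -𝟙 = :- 𝟙

  inverse₂ : ∀ a b c d w → (a * d + - (b * c)) * w ≈ 1# →
    let P = mat₂ a b c d ; Q = mat₂ (w * d) (- (w * b)) (- (w * c)) (w * a)
    in (P ⊗ Q) ≈M identity × (Q ⊗ P) ≈M identity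
  inverse₂ a b c d w det·w≈1 = PQ≈I , QP≈I
    where
    P Q : Matrix 2
    P = mat₂ a b c d
    Q = mat₂ (w * d) (- (w * b)) (- (w * c)) (w * a)
    Z≈0 : (a * d + - (b * c)) * w + - 1# ≈ 0#
    Z≈0 = trans (+-congʳ det·w≈1) (-‿inverseʳ 1#)
    Ẑ : ∀ {n} → Polynomial n → Polynomial n → Polynomial n → Polynomial n → Polynomial n → Polynomial n
    Ẑ a b c d w = (a :* d :- b :* c) :* w :- 𝟙
    PQ≈I : (P ⊗ Q) ≈M identity
    PQ≈I zero zero = trans (⊗₂ P Q zero zero) (modulo Z≈0 (solve 5 (λ a b c d w →
      a :* (w :* d) :+ b :* (:- (w :* c)) := 𝟙 :+ 𝟙 :* Ẑ a b c d w) refl a b c d w))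
    PQ≈I zero (suc zero) = trans (⊗₂ P Q zero (suc zero)) (solve 3 (λ a b w →
      a :* (:- (w :* b)) :+ b :* (w :* a) := 𝟘) refl a b w)
    PQ≈I (suc zero) zero = trans (⊗₂ P Q (suc zero) zero) (solve 3 (λ c d w →
      c :* (w :* d) :+ d :* (:- (w :* c)) := 𝟘) refl c d w)
    PQ≈I (suc zero) (suc zero) = trans (⊗₂ P Q (suc zero) (suc zero)) (modulo Z≈0 (solve 5 (λ a b c d w →
      c :* (:- (w :* b)) :+ d :* (w :* a) := 𝟙 :+ 𝟙 :* Ẑ a b c d w) refl a b c d w))
    QP≈I : (Q ⊗ P) ≈M identity
    QP≈I zero zero = trans (⊗₂ Q P zero zero) (modulo Z≈0 (solve 5 (λ a b c d w →
      (w :* d) :* a :+ (:- (w :* b)) :* c := 𝟙 :+ 𝟙 :* Ẑ a b c d w) refl a b c d w))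
    QP≈I zero (suc zero) = trans (⊗₂ Q P zero (suc zero)) (solve 3 (λ b d w →
      (w :* d) :* b :+ (:- (w :* b)) :* d := 𝟘) refl b d w)
    QP≈I (suc zero) zero = trans (⊗₂ Q P (suc zero) zero) (solve 3 (λ a c w →
      (:- (w :* c)) :* a :+ (w :* a) :* c := 𝟘) refl a c w)
    QP≈I (suc zero) (suc zero) = trans (⊗₂ Q P (suc zero) (suc zero)) (modulo Z≈0 (solve 5 (λ a b c d w →
      (:- (w :* c)) :* b :+ (w :* a) :* d := 𝟙 :+ 𝟙 :* Ẑ a b c d w) refl a b c d w))

  EigenColumns : Matrix 2 → Matrix 2 → Carrier → Carrier → Set ℓ
  EigenColumns M P ev₁ ev₂ = ∀ i j →
    M i zero * P zero j + M i (suc zero) * P (suc zero) j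
      ≈ P i zero * diag (vec₂ ev₁ ev₂) zero j + P i (suc zero) * diag (vec₂ ev₁ ev₂) (suc zero) j

  eigenbasis₂ : ∀ (M : Matrix 2) a b c d w ev₁ ev₂ → (a * d + - (b * c)) * w ≈ 1# →
    EigenColumns M (mat₂ a b c d) ev₁ ev₂ → Diagonalizable M
  eigenbasis₂ M a b c d w ev₁ ev₂ det·w≈1 eigen =
    eigenbasis⇒diagonalizable M P Q (vec₂ ev₁ ev₂) (proj₁ (inverse₂ a b c d w det·w≈1)) (proj₂ (inverse₂ a b c d w det·w≈1))
      (λ i j → trans (⊗₂ M P i j) (trans (eigen i j) (sym (⊗₂ P (diag (vec₂ ev₁ ev₂)) i j))))
    where
    P Q : Matrix 2
    P = mat₂ a b c d
    Q = mat₂ (w * d) (- (w * b)) (- (w * c)) (w * a)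

  module TwoByTwo (M : Matrix 2) where
    A B C D : Carrier
    A = M zero zero
    B = M zero (suc zero)
    C = M (suc zero) zero
    D = M (suc zero) (suc zero)

    charPoly : Carrier → Carrier
    charPoly x = x * x + - ((A + D) * x) + (A * D + - (B * C))

    discriminant : Carrier
    discriminant = (A + - D) * (A + - D) + fromℕ 4 * (B * C)

    charPolŷ : ∀ {n} → Polynomial n → Polynomial n → Polynomial n → Polynomial n → Polynomial n → Polynomial n
    charPolŷ A B C D x = x :* x :- (A :+ D) :* x :+ (A :* D :- B :* C)

    eigenvalue : AlgClosed → Σ Carrier (λ x → charPoly x ≈ 0#)
    eigenvalue closed with closed 1 (vec₂ (A * D + - (B * C)) (- (A + D)))
    ... | x , root = x , trans (solve 5 (λ A B C D x → charPolŷ A B C D x :=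
            x :* (x :* 𝟙) :+ ((A :* D :- B :* C) :* 𝟙 :+ ((:- (A :+ D)) :* (x :* 𝟙) :+ 𝟘))) refl A B C D x) root

    module Eigenvalues (x : Carrier) (χx≈0 : charPoly x ≈ 0#) (Δ≉0 : ¬ discriminant ≈ 0#) where
      -- the other root of the characteristic polynomial
      x′ : Carrier
      x′ = A + D + - x

      gap≉0 : ¬ x′ + - x ≈ 0#
      gap≉0 gap≈0 = Δ≉0 (modulo χx≈0 (modulo gap≈0 (solve 5 (λ A B C D x →
        (A :- D) :* (A :- D) :+ con (+ 4) :* (B :* C) :=
        𝟘 :+ (:- con (+ 4)) :* charPolŷ A B C D x :+ ((A :+ D :- x) :- x) :* ((A :+ D :- x) :- x)) refl A B C D x)))

      diagonalizable-B : ¬ B ≈ 0# → Diagonalizable M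
      diagonalizable-B B≉0 = eigenbasis₂ M B B (x + - A) (x′ + - A) w x x′ det·w≈1 eigen
        where
        det≉0 : ¬ B * (x′ + - A) + - (B * (x + - A)) ≈ 0#
        det≉0 det≈0 = *-nonzero B≉0 gap≉0 (trans (solve 5 (λ A B C D x →
          B :* ((A :+ D :- x) :- x) := B :* ((A :+ D :- x) :- A) :- B :* (x :- A)) refl A B C D x) det≈0)
        w : Carrier
        w = proj₁ (inverse _ det≉0)
        det·w≈1 : (B * (x′ + - A) + - (B * (x + - A))) * w ≈ 1#
        det·w≈1 = proj₂ (inverse _ det≉0)
        eigen : EigenColumns M (mat₂ B B (x + - A) (x′ + - A)) x x′
        eigen zero zero = solve 3 (λ A B x → A :* B :+ B :* (x :- A) := B :* x :+ B :* 𝟘) refl A B x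
        eigen zero (suc zero) = solve 4 (λ A B D x → A :* B :+ B :* ((A :+ D :- x) :- A) := B :* 𝟘 :+ B :* (A :+ D :- x)) refl A B D x
        eigen (suc zero) zero = modulo χx≈0 (solve 5 (λ A B C D x →
          C :* B :+ D :* (x :- A) := (x :- A) :* x :+ ((A :+ D :- x) :- A) :* 𝟘 :+ -𝟙 :* charPolŷ A B C D x) refl A B C D x)
        eigen (suc zero) (suc zero) = modulo χx≈0 (solve 5 (λ A B C D x →
          C :* B :+ D :* ((A :+ D :- x) :- A) := (x :- A) :* 𝟘 :+ ((A :+ D :- x) :- A) :* (A :+ D :- x) :+ -𝟙 :* charPolŷ A B C D x) refl A B C D x)

      diagonalizable-C : ¬ C ≈ 0# → Diagonalizable M
      diagonalizable-C C≉0 = eigenbasis₂ M (x + - D) (x′ + - D) C C w x x′ det·w≈1 eigen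
        where
        det≉0 : ¬ (x + - D) * C + - ((x′ + - D) * C) ≈ 0#
        det≉0 det≈0 = *-nonzero C≉0 gap≉0 (trans (solve 5 (λ A B C D x →
          C :* ((A :+ D :- x) :- x) := :- ((x :- D) :* C :- ((A :+ D :- x) :- D) :* C)) refl A B C D x) (-‿zero det≈0))
        w : Carrier
        w = proj₁ (inverse _ det≉0)
        det·w≈1 : ((x + - D) * C + - ((x′ + - D) * C)) * w ≈ 1#
        det·w≈1 = proj₂ (inverse _ det≉0)
        eigen : EigenColumns M (mat₂ (x + - D) (x′ + - D) C C) x x′
        eigen zero zero = modulo χx≈0 (solve 5 (λ A B C D x →
          A :* (x :- D) :+ B :* C := (x :- D) :* x :+ ((A :+ D :- x) :- D) :* 𝟘 :+ -𝟙 :* charPolŷ A B C D x) refl A B C D x)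
        eigen zero (suc zero) = modulo χx≈0 (solve 5 (λ A B C D x →
          A :* ((A :+ D :- x) :- D) :+ B :* C := (x :- D) :* 𝟘 :+ ((A :+ D :- x) :- D) :* (A :+ D :- x) :+ -𝟙 :* charPolŷ A B C D x) refl A B C D x)
        eigen (suc zero) zero = solve 3 (λ C D x → C :* (x :- D) :+ D :* C := C :* x :+ C :* 𝟘) refl C D x
        eigen (suc zero) (suc zero) = solve 4 (λ A C D x → C :* ((A :+ D :- x) :- D) :+ D :* C := C :* 𝟘 :+ C :* (A :+ D :- x)) refl A C D x

    diagonalizable-diagonal : B ≈ 0# → C ≈ 0# → Diagonalizable M
    diagonalizable-diagonal B≈0 C≈0 = eigenbasis₂ M 1# 0# 0# 1# 1# A D (solve 0 ((𝟙 :* 𝟙 :- 𝟘 :* 𝟘) :* 𝟙 := 𝟙) refl) eigen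
      where
      eigen : EigenColumns M (mat₂ 1# 0# 0# 1#) A D
      eigen zero zero = solve 2 (λ A B → A :* 𝟙 :+ B :* 𝟘 := 𝟙 :* A :+ 𝟘 :* 𝟘) refl A B
      eigen zero (suc zero) = modulo B≈0 (solve 3 (λ A B D → A :* 𝟘 :+ B :* 𝟙 := 𝟙 :* 𝟘 :+ 𝟘 :* D :+ 𝟙 :* B) refl A B D)
      eigen (suc zero) zero = modulo C≈0 (solve 3 (λ A C D → C :* 𝟙 :+ D :* 𝟘 := 𝟘 :* A :+ 𝟙 :* 𝟘 :+ 𝟙 :* C) refl A C D)
      eigen (suc zero) (suc zero) = solve 2 (λ C D → C :* 𝟘 :+ D :* 𝟙 := 𝟘 :* 𝟘 :+ 𝟙 :* D) refl C D

    diagonalizable : AlgClosed → ¬ discriminant ≈ 0# → ¬ B ≈ 0# ⊎ ¬ C ≈ 0# → Diagonalizable M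
    diagonalizable closed Δ≉0 (inj₁ B≉0) = Eigenvalues.diagonalizable-B (proj₁ (eigenvalue closed)) (proj₂ (eigenvalue closed)) Δ≉0 B≉0
    diagonalizable closed Δ≉0 (inj₂ C≉0) = Eigenvalues.diagonalizable-C (proj₁ (eigenvalue closed)) (proj₂ (eigenvalue closed)) Δ≉0 C≉0

module CharacteristicP {c ℓ} (K : Field c ℓ) (p : ℕ) (p-prime : Prime p) (charK : FieldOps.HasChar K p) where
  open import Data.Nat.Combinatorics using (_C_; nCk+nC[k+1]≡[n+1]C[k+1]; nCn≡1; k>n⇒nCk≡0)
  open Field K
  open FieldOps K
  open FieldLemmas K
  open import Relation.Binary.Reasoning.Setoid setoid

  1<p : 1 ℕ.< p
  1<p = ℕ.nonTrivial⇒n>1 p {{prime⇒nonTrivial p-prime}}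

  fromℕ-multiple : ∀ {n} → fromℕ n ≈ 0# → ∀ x → fromℕ (x ℕ.* n) ≈ 0#
  fromℕ-multiple n≈0 x = trans (fromℕ-* x _) (trans (*-congˡ n≈0) (zeroʳ _))

  p∣⇒fromℕ≈0 : ∀ {n} → p ∣ n → fromℕ n ≈ 0#
  p∣⇒fromℕ≈0 (divides m n≡m*p) = trans (fromℕ-cong n≡m*p) (fromℕ-multiple charK m)

  p∤⇒coprime : ∀ {n} → ¬ p ∣ n → Coprime n p
  p∤⇒coprime p∤n (d∣n , d∣p) with prime⇒irreducible p-prime d∣p
  ... | inj₁ d≡1 = d≡1
  ... | inj₂ ≡.refl = ⊥-elim (p∤n d∣n)

  -- an integer prime to p is nonzero in K: by Bézout, 1 would be a
  -- combination of n and p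
  p∤⇒fromℕ≉0 : ∀ {n} → ¬ p ∣ n → ¬ fromℕ n ≈ 0#
  p∤⇒fromℕ≉0 {n} p∤n n≈0 with coprime-Bézout (p∤⇒coprime p∤n)
  ... | GCD.Bézout.+- x y 1+yp≡xn = 1≉0 (begin
    1#                        ≈⟨ +-identityʳ 1# ⟨
    1# + 0#                   ≈⟨ +-congˡ (fromℕ-multiple charK y) ⟨
    fromℕ (1 ℕ.+ y ℕ.* p)     ≈⟨ fromℕ-cong 1+yp≡xn ⟩
    fromℕ (x ℕ.* n)           ≈⟨ fromℕ-multiple n≈0 x ⟩
    0#                        ∎)
  ... | GCD.Bézout.-+ x y 1+xn≡yp = 1≉0 (begin
    1#                        ≈⟨ +-identityʳ 1# ⟨
    1# + 0#                   ≈⟨ +-congˡ (fromℕ-multiple n≈0 x) ⟨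
    fromℕ (1 ℕ.+ x ℕ.* n)     ≈⟨ fromℕ-cong 1+xn≡yp ⟩
    fromℕ (y ℕ.* p)           ≈⟨ fromℕ-multiple charK y ⟩
    0#                        ∎)

  fromℕ4≉0 : p ≢ 2 → ¬ fromℕ 4 ≈ 0#
  fromℕ4≉0 p≢2 = p∤⇒fromℕ≉0 p∤4
    where
    p∤4 : ¬ p ∣ 4
    p∤4 p∣4 with euclidsLemma 2 2 p-prime p∣4
    ... | inj₁ p∣2 = p≢2 (ℕ.≤-antisym (Div.∣⇒≤ p∣2) 1<p)
    ... | inj₂ p∣2 = p≢2 (ℕ.≤-antisym (Div.∣⇒≤ p∣2) 1<p)

  -- -1 = p - 1 lies in the prime field
  -1∈ : InPrimeField (- 1#)
  -1∈ = p ℕ.∸ 1 , sym (+-inverseʳ-unique 1# _ (trans (sym (fromℕ-cong p≡1+[p-1])) charK))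
    where
    p≡1+[p-1] : p ≡ suc (p ℕ.∸ 1)
    p≡1+[p-1] = ≡.sym (ℕ.m+[n∸m]≡n (ℕ.<⇒≤ 1<p))

  module PrimePower (r : ℕ) where
    q : ℕ
    q = p ℕ.^ r

    0<q : 0 ℕ.< q
    0<q = ℕ.m^n>0 p {{prime⇒nonZero p-prime}} r

    binomial-q-inner : ∀ i → 0 ℕ.< i → i ℕ.< q → fromℕ (q C i) ≈ 0#
    binomial-q-inner i 0<i i<q = p∣⇒fromℕ≈0 (prime∣primePowerBinomial r p-prime i 0<i i<q)

    binomial-q : ∀ y → fromℕ (q C y) ≈ fromℕ (0 C y) + fromℕ (shiftedBinom q 0 y)
    binomial-q zero = trans (sym (+-identityʳ _)) (+-congˡ (fromℕ-cong (≡.sym (shiftedBinom-< q 0 0 0<q))))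
    binomial-q (suc y) with ℕ.<-cmp (suc y) q
    ... | tri< y<q _ _ = trans (binomial-q-inner (suc y) (ℕ.s≤s ℕ.z≤n) y<q)
                              (sym (trans (+-identityˡ _) (fromℕ-cong (shiftedBinom-< q 0 (suc y) y<q))))
    ... | tri≈ _ y≡q _ = begin
      fromℕ (q C suc y)                 ≡⟨ ≡.cong (λ n → fromℕ (q C n)) y≡q ⟩
      fromℕ (q C q)                     ≡⟨ ≡.cong fromℕ (nCn≡1 q) ⟩
      fromℕ 1                           ≈⟨ +-identityˡ _ ⟨
      0# + fromℕ 1                      ≡⟨ ≡.cong (λ n → 0# + fromℕ n) shifted≡1 ⟨
      0# + fromℕ (shiftedBinom q 0 (suc y)) ∎
      where
      shifted≡1 : shiftedBinom q 0 (suc y) ≡ 1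
      shifted≡1 = ≡.trans (shiftedBinom-≥ q 0 (suc y) (ℕ.≤-reflexive (≡.sym y≡q)))
                          (≡.cong (0 C_) (ℕ.m≤n⇒m∸n≡0 (ℕ.≤-reflexive y≡q)))
    ... | tri> _ _ q<y = begin
      fromℕ (q C suc y)                 ≡⟨ ≡.cong fromℕ (k>n⇒nCk≡0 q<y) ⟩
      0#                                ≈⟨ +-identityˡ _ ⟨
      0# + 0#                           ≡⟨ ≡.cong (λ n → 0# + fromℕ n) shifted≡0 ⟨
      0# + fromℕ (shiftedBinom q 0 (suc y)) ∎
      where
      shifted≡0 : shiftedBinom q 0 (suc y) ≡ 0
      shifted≡0 = ≡.trans (shiftedBinom-≥ q 0 (suc y) (ℕ.<⇒≤ q<y))
                          (≡.cong (0 C_) (ℕ.+-∸-assoc 1 (ℕ.≤-pred q<y)))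

    -- (1 + X)^(q + x) = (1 + X^q)(1 + X)^x in characteristic p, coefficientwise
    binomial-q+ : ∀ x y → fromℕ ((q ℕ.+ x) C y) ≈ fromℕ (x C y) + fromℕ (shiftedBinom q x y)
    binomial-q+ zero y = trans (fromℕ-cong (≡.cong (_C y) (ℕ.+-identityʳ q))) (binomial-q y)
    binomial-q+ (suc x) zero = trans (sym (+-identityʳ _)) (+-congˡ (fromℕ-cong (≡.sym (shiftedBinom-< q (suc x) 0 0<q))))
    binomial-q+ (suc x) (suc y) = begin
      fromℕ ((q ℕ.+ suc x) C suc y)
        ≡⟨ ≡.cong (λ n → fromℕ (n C suc y)) (ℕ.+-suc q x) ⟩
      fromℕ (suc (q ℕ.+ x) C suc y)
        ≡⟨ ≡.cong fromℕ (nCk+nC[k+1]≡[n+1]C[k+1] (q ℕ.+ x) y) ⟨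
      fromℕ ((q ℕ.+ x) C y ℕ.+ (q ℕ.+ x) C suc y)
        ≈⟨ fromℕ-+ ((q ℕ.+ x) C y) ((q ℕ.+ x) C suc y) ⟩
      fromℕ ((q ℕ.+ x) C y) + fromℕ ((q ℕ.+ x) C suc y)
        ≈⟨ +-cong (binomial-q+ x y) (binomial-q+ x (suc y)) ⟩
      (fromℕ (x C y) + fromℕ (shiftedBinom q x y)) + (fromℕ (x C suc y) + fromℕ (shiftedBinom q x (suc y)))
        ≈⟨ interchange _ _ _ _ ⟩
      (fromℕ (x C y) + fromℕ (x C suc y)) + (fromℕ (shiftedBinom q x y) + fromℕ (shiftedBinom q x (suc y)))
        ≈⟨ +-cong (fromℕ-+ (x C y) (x C suc y)) (fromℕ-+ (shiftedBinom q x y) (shiftedBinom q x (suc y))) ⟨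
      fromℕ (x C y ℕ.+ x C suc y) + fromℕ (shiftedBinom q x y ℕ.+ shiftedBinom q x (suc y))
        ≡⟨ ≡.cong₂ (λ m n → fromℕ m + fromℕ n) (nCk+nC[k+1]≡[n+1]C[k+1] x y) (shiftedBinom-pascal q x y) ⟩
      fromℕ (suc x C suc y) + fromℕ (shiftedBinom q (suc x) (suc y)) ∎
      where open import Algebra.Properties.CommutativeSemigroup +-commutativeSemigroup using (interchange)

    binomial-q-1 : ∀ {D} → suc D ≡ q → ∀ y → y ℕ.≤ D → fromℕ (D C y) ≈ pow (- 1#) y
    binomial-q-1 1+D≡q zero _ = +-identityʳ 1#
    binomial-q-1 {D} 1+D≡q (suc y) 1+y≤D = begin
      fromℕ (D C suc y)      ≈⟨ +-inverseʳ-unique _ _ pascal-vanishes ⟩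
      - fromℕ (D C y)        ≈⟨ -‿cong (binomial-q-1 1+D≡q y (ℕ.≤-trans (ℕ.n≤1+n y) 1+y≤D)) ⟩
      - pow (- 1#) y         ≈⟨ -1*x≈-x _ ⟨
      pow (- 1#) (suc y)     ∎
      where
      pascal-vanishes : fromℕ (D C y) + fromℕ (D C suc y) ≈ 0#
      pascal-vanishes = begin
        fromℕ (D C y) + fromℕ (D C suc y)   ≈⟨ fromℕ-+ (D C y) (D C suc y) ⟨
        fromℕ (D C y ℕ.+ D C suc y)         ≡⟨ ≡.cong fromℕ (≡.trans (nCk+nC[k+1]≡[n+1]C[k+1] D y) (≡.cong (_C suc y) 1+D≡q)) ⟩
        fromℕ (q C suc y)                   ≈⟨ binomial-q-inner (suc y) (ℕ.s≤s ℕ.z≤n) (≡.subst (suc y ℕ.<_) 1+D≡q (ℕ.s≤s 1+y≤D)) ⟩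
        0#                                  ∎

    binomial-q+-low : ∀ x y → y ℕ.< q → fromℕ ((q ℕ.+ x) C y) ≈ fromℕ (x C y)
    binomial-q+-low x y y<q = trans (binomial-q+ x y)
      (trans (+-congˡ (fromℕ-cong (shiftedBinom-< q x y y<q))) (+-identityʳ _))

    binomial-q+-high : ∀ x y → x ℕ.< y → q ℕ.≤ y → fromℕ ((q ℕ.+ x) C y) ≈ fromℕ (x C (y ℕ.∸ q))
    binomial-q+-high x y x<y q≤y = trans (binomial-q+ x y)
      (trans (+-cong (fromℕ-cong (k>n⇒nCk≡0 x<y)) (fromℕ-cong (shiftedBinom-≥ q x y q≤y))) (+-identityˡ _))

module Transcendence {c ℓ} (K : Field c ℓ) (t : Field.Carrier K) (transcendental : FieldOps.Transcendental K t) where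
  open Field K hiding (zero)
  open FieldOps K
  open FieldLemmas K
  open Matrices K
  open import Relation.Binary.Reasoning.Setoid setoid

  evalPoly-monomial : ∀ v n → evalPoly (map fromℕ (replicate n 0 ++ v ∷ [])) t ≈ pow t n * fromℕ v
  evalPoly-monomial v zero = solve 2 (λ t v → v :+ t :* con (+ 0) := con (+ 1) :* v) refl t (fromℕ v)
  evalPoly-monomial v (suc n) = begin
    0# + t * evalPoly (map fromℕ (replicate n 0 ++ v ∷ [])) t ≈⟨ +-congˡ (*-congˡ (evalPoly-monomial v n)) ⟩
    0# + t * (pow t n * fromℕ v)                               ≈⟨ solve 3 (λ t a v → con (+ 0) :+ t :* (a :* v) := (t :* a) :* v) refl t (pow t n) (fromℕ v) ⟩
    (t * pow t n) * fromℕ v                                    ∎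

  separate : ∀ {u v} → InPrimeField u → InPrimeField v → ∀ n → u + pow t (suc n) * v ≈ 0# → u ≈ 0# × v ≈ 0#
  separate {u} {v} (a , u≈a) (b , v≈b) n u+tv≈0 with transcendental (a ∷ replicate n 0 ++ b ∷ []) vanishes
    where
    vanishes : evalPoly (map fromℕ (a ∷ replicate n 0 ++ b ∷ [])) t ≈ 0#
    vanishes = begin
      fromℕ a + t * evalPoly (map fromℕ (replicate n 0 ++ b ∷ [])) t ≈⟨ +-congˡ (*-congˡ (evalPoly-monomial b n)) ⟩
      fromℕ a + t * (pow t n * fromℕ b)                              ≈⟨ +-congˡ (*-assoc t _ _) ⟨
      fromℕ a + pow t (suc n) * fromℕ b                              ≈⟨ +-cong u≈a (*-congˡ v≈b) ⟨
      u + pow t (suc n) * v                                          ≈⟨ u+tv≈0 ⟩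
      0#                                                             ∎
  ... | a≈0 ∷ rest with ++⁻ʳ (replicate n 0) rest
  ...   | b≈0 ∷ _ = trans u≈a a≈0 , trans v≈b b≈0

  t≉0 : ¬ t ≈ 0#
  t≉0 t≈0 = 1≉0 (proj₂ (separate (fromℕ∈ 0) (1 , sym (+-identityʳ 1#)) 0 t·1≈0))
    where
    t·1≈0 : 0# + pow t 1 * 1# ≈ 0#
    t·1≈0 = trans (+-identityˡ _) (trans (*-identityʳ _) (trans (*-identityʳ t) t≈0))

  -- The discriminant of a 2 × 2 matrix of the shape of U_t on a class
  -- {a, c} with c - a = n + 1: its t-adic expansion separates α² and 4βγ.
  discriminant≈0⇒ : ∀ (M : Matrix 2) a n {α β γ} → InPrimeField α → InPrimeField β → InPrimeField γ →
    M zero zero ≈ - (pow (- t) (suc a) * α) → M zero (suc zero) ≈ - (pow t (suc a ℕ.+ suc n) * β) →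
    M (suc zero) zero ≈ - (pow t (suc a) * γ) → M (suc zero) (suc zero) ≈ 0# →
    TwoByTwo.discriminant M ≈ 0# → α * α ≈ 0# × fromℕ 4 * (β * γ) ≈ 0#
  discriminant≈0⇒ M a n {α} {β} {γ} α∈ β∈ γ∈ A≈ B≈ C≈ D≈0 Δ≈0 =
    separate (*-∈ α∈ α∈) (*-∈ (fromℕ∈ 4) (*-∈ β∈ γ∈)) n (cancel-nonzero T²≉0 (trans (sym expansion) Δ≈0))
    where
    open TwoByTwo M
    T S U : Carrier
    T = pow t (suc a)
    S = pow t (suc n)
    U = pow (- t) (suc a)
    T²≉0 : ¬ T * T ≈ 0#
    T²≉0 = *-nonzero (pow-nonzero t≉0 (suc a)) (pow-nonzero t≉0 (suc a))
    expansion : discriminant ≈ (T * T) * (α * α + S * (fromℕ 4 * (β * γ)))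
    expansion = begin
      (A + - D) * (A + - D) + fromℕ 4 * (B * C)
        ≈⟨ +-cong (*-cong (+-cong A≈ (-‿zero D≈0)) (+-cong A≈ (-‿zero D≈0))) (*-congˡ (*-cong (trans B≈ (-‿cong (*-congʳ (pow-+ t (suc a) (suc n))))) C≈)) ⟩
      (- (U * α) + 0#) * (- (U * α) + 0#) + fromℕ 4 * (- ((T * S) * β) * - (T * γ))
        ≈⟨ solve 6 (λ U T S α β γ →
             (:- (U :* α) :+ con (+ 0)) :* (:- (U :* α) :+ con (+ 0)) :+ con (+ 4) :* (:- ((T :* S) :* β) :* :- (T :* γ))
             := (U :* U) :* (α :* α) :+ (T :* T) :* (S :* (con (+ 4) :* (β :* γ)))) refl U T S α β γ ⟩
      (U * U) * (α * α) + (T * T) * (S * (fromℕ 4 * (β * γ)))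
        ≈⟨ +-congʳ (*-congʳ (pow-neg-square t (suc a))) ⟩
      (T * T) * (α * α) + (T * T) * (S * (fromℕ 4 * (β * γ)))
        ≈⟨ distribˡ _ _ _ ⟨
      (T * T) * (α * α + S * (fromℕ 4 * (β * γ))) ∎

module AtkinCoefficients {c ℓ} (K : Field c ℓ) (t : Field.Carrier K) (k : ℕ) where
  open import Data.Nat.Combinatorics using (_C_)
  open Field K hiding (zero)
  open FieldOps K

  diagCoeff : ℕ → Carrier
  diagCoeff a = fromℕ ((k ∸ 2 ∸ a) C a)

  offCoeff : ℕ → ℕ → Carrier
  offCoeff a c = fromℕ (binomNeg (k ∸ 2 ∸ c) a c) + pow (- 1#) (suc a) * fromℕ ((k ∸ 2 ∸ c) C a)

  Ucoeff-diag : ∀ a → Ucoeff t k a a ≡ - (pow (- t) (suc a) * diagCoeff a)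
  Ucoeff-diag a with a ℕ.≟ a
  ... | yes _ = ≡.refl
  ... | no a≢a = ⊥-elim (a≢a ≡.refl)

  Ucoeff-off : ∀ a c → a ≢ c → Ucoeff t k a c ≡ - (pow t (suc a) * offCoeff a c)
  Ucoeff-off a c a≢c with a ℕ.≟ c
  ... | yes a≡c = ⊥-elim (a≢c a≡c)
  ... | no _ = ≡.refl

  binomNeg-≤ : ∀ n a c → c ℕ.≤ a → binomNeg n a c ≡ n C (a ∸ c)
  binomNeg-≤ n a c c≤a with c ≤ᵇ a in eq
  ... | true = ≡.refl
  ... | false = ⊥-elim (≡.subst Bool.T eq (ℕ.≤⇒≤ᵇ c≤a))

  binomNeg-> : ∀ n a c → a ℕ.< c → binomNeg n a c ≡ 0
  binomNeg-> n a c a<c with c ≤ᵇ a in eq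
  ... | true = ⊥-elim (ℕ.<⇒≱ a<c (ℕ.≤ᵇ⇒≤ c a (≡.subst Bool.T (≡.sym eq) tt)))
  ... | false = ≡.refl

  classMatrix : (L : List ℕ) → FieldOps.Matrix K (length L)
  classMatrix L row col = Ucoeff t k (lookup L col) (lookup L row)

  classMatrix-cong : ∀ {L L′} → L ≡ L′ → Diagonalizable (classMatrix L′) → Diagonalizable (classMatrix L)
  classMatrix-cong ≡.refl diagonalizable = diagonalizable

-- U_t on a class C_j = {j, b} with b = j + (q - 1) and k - 2 = b + e, where
-- q = p^r, 0 ≤ j, e ≤ q - 2.
module TwoElementClass {c ℓ} (K : Field c ℓ) (closed : FieldOps.AlgClosed K)
  (p : ℕ) (p-prime : Prime p) (p≢2 : p ≢ 2) (charK : FieldOps.HasChar K p) (r : ℕ) (1≤r : 1 ℕ.≤ r)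
  (t : Field.Carrier K) (transcendental : FieldOps.Transcendental K t)
  (k j e : ℕ) (j≤q-2 : j ℕ.≤ p ℕ.^ r ∸ 2) (e≤q-2 : e ℕ.≤ p ℕ.^ r ∸ 2)
  (k-1≡ : k ∸ 1 ≡ suc (j ℕ.+ suc (p ℕ.^ r ∸ 2)) ℕ.+ e) where
  open import Data.Nat.Combinatorics using (_C_; nCk+nC[k+1]≡[n+1]C[k+1]; nCn≡1; k>n⇒nCk≡0)
  open Field K hiding (zero)
  open FieldOps K
  open FieldLemmas K
  open Matrices K
  open CharacteristicP K p p-prime charK
  open PrimePower r
  open Transcendence K t transcendental
  open AtkinCoefficients K t k
  open import Relation.Binary.Reasoning.Setoid setoid

  D′ D b : ℕ
  D′ = q ∸ 2
  D = suc D′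
  b = j ℕ.+ D

  1+D≡q : suc D ≡ q
  1+D≡q = ℕ.m+[n∸m]≡n {2} (ℕ.≤-trans 1<p p≤q)
    where
    p≤q : p ℕ.≤ q
    p≤q = ≡.subst (ℕ._≤ q) (ℕ.*-identityʳ p) (ℕ.^-monoʳ-≤ p {{prime⇒nonZero p-prime}} 1≤r)

  j<b : j ℕ.< b
  j<b = ℕ.m<m+n j ℕ.z<s

  j<q : j ℕ.< q
  j<q = ≡.subst (j ℕ.<_) 1+D≡q (ℕ.s≤s (ℕ.≤-trans j≤q-2 (ℕ.n≤1+n D′)))

  e<b : e ℕ.< b
  e<b = ℕ.<-≤-trans (ℕ.s≤s e≤q-2) (ℕ.m≤n+m D j)

  k-2≡ : k ∸ 2 ≡ b ℕ.+ e
  k-2≡ = ≡.trans (≡.sym (ℕ.pred[m∸n]≡m∸[1+n] k 1)) (≡.cong ℕ.pred k-1≡)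

  k-2-j≡ : k ∸ 2 ∸ j ≡ D ℕ.+ e
  k-2-j≡ = ≡.trans (≡.cong (_∸ j) (≡.trans k-2≡ (ℕ.+-assoc j D e))) (ℕ.m+n∸m≡n j (D ℕ.+ e))

  k-2-b≡ : k ∸ 2 ∸ b ≡ e
  k-2-b≡ = ≡.trans (≡.cong (_∸ b) k-2≡) (ℕ.m+n∸m≡n b e)

  M : Matrix 2
  M = classMatrix (j ∷ b ∷ [])
  module M₂ = TwoByTwo M

  sign : ℕ → Carrier
  sign a = pow (- 1#) (suc a)

  α β γ : Carrier
  α = diagCoeff j
  β = offCoeff b j
  γ = offCoeff j b

  α≡ : α ≡ fromℕ ((D ℕ.+ e) C j)
  α≡ = ≡.cong (λ n → fromℕ (n C j)) k-2-j≡

  β≈ : β ≈ fromℕ ((D ℕ.+ e) C D) + sign b * fromℕ ((D ℕ.+ e) C b)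
  β≈ = reflexive (≡.cong₂ (λ m n → fromℕ m + sign b * fromℕ n)
         (≡.trans (binomNeg-≤ _ b j (ℕ.<⇒≤ j<b)) (≡.cong₂ _C_ k-2-j≡ (ℕ.m+n∸m≡n j D)))
         (≡.cong (_C b) k-2-j≡))

  γ≈ : γ ≈ sign j * fromℕ (e C j)
  γ≈ = trans (reflexive (≡.cong₂ (λ m n → fromℕ m + sign j * fromℕ n) (binomNeg-> _ j b j<b) (≡.cong (_C j) k-2-b≡)))
             (+-identityˡ _)

  offCoeff∈ : ∀ a c → InPrimeField (offCoeff a c)
  offCoeff∈ a c = +-∈ (fromℕ∈ (binomNeg (k ∸ 2 ∸ c) a c)) (*-∈ (pow-∈ -1∈ (suc a)) (fromℕ∈ ((k ∸ 2 ∸ c) C a)))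

  A≈ : M₂.A ≈ - (pow (- t) (suc j) * α)
  A≈ = reflexive (Ucoeff-diag j)

  B≈ : M₂.B ≈ - (pow t (suc b) * β)
  B≈ = reflexive (Ucoeff-off b j (λ b≡j → ℕ.<⇒≢ j<b (≡.sym b≡j)))

  C≈ : M₂.C ≈ - (pow t (suc j) * γ)
  C≈ = reflexive (Ucoeff-off j b (ℕ.<⇒≢ j<b))

  D≈0 : M₂.D ≈ 0#
  D≈0 = trans (reflexive (Ucoeff-diag b))
    (-‿zero (trans (*-congˡ (fromℕ-cong (≡.trans (≡.cong (_C b) k-2-b≡) (k>n⇒nCk≡0 e<b)))) (zeroʳ _)))

  discriminant≈0⇒α²≈0×4βγ≈0 : M₂.discriminant ≈ 0# → α * α ≈ 0# × fromℕ 4 * (β * γ) ≈ 0#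
  discriminant≈0⇒α²≈0×4βγ≈0 = discriminant≈0⇒ M j D′ (fromℕ∈ ((k ∸ 2 ∸ j) C j)) (offCoeff∈ b j) (offCoeff∈ j b) A≈ B≈ C≈ D≈0

  scaled-zero : ∀ {x} n → x ≈ 0# → - (pow t n * x) ≈ 0#
  scaled-zero n x≈0 = -‿zero (trans (*-congˡ x≈0) (zeroʳ _))

  scaled-nonzero : ∀ {x} n → ¬ x ≈ 0# → ¬ - (pow t n * x) ≈ 0#
  scaled-nonzero n x≉0 = -‿nonzero (*-nonzero (pow-nonzero t≉0 n) x≉0)

  diagonal-case : β ≈ 0# → γ ≈ 0# → Diagonalizable M
  diagonal-case β≈0 γ≈0 = M₂.diagonalizable-diagonal (trans B≈ (scaled-zero (suc b) β≈0)) (trans C≈ (scaled-zero (suc j) γ≈0))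

  off-diagonal-nonzero : ¬ β ≈ 0# ⊎ ¬ γ ≈ 0# → ¬ M₂.B ≈ 0# ⊎ ¬ M₂.C ≈ 0#
  off-diagonal-nonzero (inj₁ β≉0) = inj₁ (nonzero-resp B≈ (scaled-nonzero (suc b) β≉0))
  off-diagonal-nonzero (inj₂ γ≉0) = inj₂ (nonzero-resp C≈ (scaled-nonzero (suc j) γ≉0))

  α-case : ¬ α ≈ 0# → ¬ β ≈ 0# ⊎ ¬ γ ≈ 0# → Diagonalizable M
  α-case α≉0 β≉0⊎γ≉0 = M₂.diagonalizable closed
    (λ Δ≈0 → *-nonzero α≉0 α≉0 (proj₁ (discriminant≈0⇒α²≈0×4βγ≈0 Δ≈0))) (off-diagonal-nonzero β≉0⊎γ≉0)

  βγ-case : ¬ β ≈ 0# → ¬ γ ≈ 0# → Diagonalizable M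
  βγ-case β≉0 γ≉0 = M₂.diagonalizable closed
    (λ Δ≈0 → *-nonzero (fromℕ4≉0 p≢2) (*-nonzero β≉0 γ≉0) (proj₂ (discriminant≈0⇒α²≈0×4βγ≈0 Δ≈0)))
    (off-diagonal-nonzero (inj₁ β≉0))

  sign-nonzero : ∀ a → ¬ sign a ≈ 0#
  sign-nonzero a = pow-nonzero (-‿nonzero 1≉0) (suc a)

  fromℕ1≉0 : ¬ fromℕ 1 ≈ 0#
  fromℕ1≉0 = nonzero-resp (+-identityʳ 1#) 1≉0

  -- j = 0: α = C(D + e, 0) = 1 and γ = -C(e, 0) = -1
  case-j≡0 : j ≡ 0 → Diagonalizable M
  case-j≡0 j≡0 = α-case α≉0 (inj₂ γ≉0)
    where
    α≉0 : ¬ α ≈ 0#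
    α≉0 = nonzero-resp (reflexive (≡.trans α≡ (≡.cong (λ i → fromℕ ((D ℕ.+ e) C i)) j≡0))) fromℕ1≉0
    γ≉0 : ¬ γ ≈ 0#
    γ≉0 = nonzero-resp (trans γ≈ (*-congˡ (fromℕ-cong (≡.cong (e C_) j≡0)))) (*-nonzero (sign-nonzero j) fromℕ1≉0)

  -- j > 0, e = 0: α = C(q - 1, j) = (-1)^j and β = C(q - 1, q - 1) + sign·C(q - 1, b) = 1
  case-e≡0 : ∀ {j′} → j ≡ suc j′ → e ≡ 0 → Diagonalizable M
  case-e≡0 {j′} j≡ e≡0 = α-case α≉0 (inj₁ β≉0)
    where
    D+e≡D : D ℕ.+ e ≡ D
    D+e≡D = ≡.trans (≡.cong (D ℕ.+_) e≡0) (ℕ.+-identityʳ D)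
    α≉0 : ¬ α ≈ 0#
    α≉0 = nonzero-resp (trans (reflexive (≡.trans α≡ (≡.cong (λ n → fromℕ (n C j)) D+e≡D)))
                              (binomial-q-1 1+D≡q j (ℕ.≤-trans j≤q-2 (ℕ.n≤1+n D′))))
                       (pow-nonzero (-‿nonzero 1≉0) j)
    D<b : D ℕ.< b
    D<b = ≡.subst (λ i → D ℕ.< i ℕ.+ D) (≡.sym j≡) (ℕ.m<n+m D ℕ.z<s)
    β≈1 : β ≈ fromℕ 1
    β≈1 = begin
      β                                              ≈⟨ β≈ ⟩
      fromℕ ((D ℕ.+ e) C D) + sign b * fromℕ ((D ℕ.+ e) C b)
        ≡⟨ ≡.cong₂ (λ m n → fromℕ m + sign b * fromℕ n)
             (≡.trans (≡.cong (_C D) D+e≡D) (nCn≡1 D)) (≡.trans (≡.cong (_C b) D+e≡D) (k>n⇒nCk≡0 D<b)) ⟩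
      fromℕ 1 + sign b * 0#                           ≈⟨ +-congˡ (zeroʳ _) ⟩
      fromℕ 1 + 0#                                    ≈⟨ +-identityʳ _ ⟩
      fromℕ 1                                         ∎
    β≉0 : ¬ β ≈ 0#
    β≉0 = nonzero-resp β≈1 fromℕ1≉0

  -- j = j′ + 1, e = e′ + 1: with X = C(e′, j′) and Y = C(e′, j), Lucas-type
  -- reduction gives α = Y, β = ±X and γ = ±(X + Y); decide which vanish mod p.
  case-generic : ∀ {j′ e′} → j ≡ suc j′ → e ≡ suc e′ → Diagonalizable M
  case-generic {j′} {e′} j≡ e≡ = decide (p ∣? e′ C j′) (p ∣? e′ C j)
    where
    X Y : Carrier
    X = fromℕ (e′ C j′)
    Y = fromℕ (e′ C j)
    D+e≡q+e′ : D ℕ.+ e ≡ q ℕ.+ e′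
    D+e≡q+e′ = ≡.trans (≡.cong (D ℕ.+_) e≡) (≡.trans (ℕ.+-suc D e′) (≡.cong (ℕ._+ e′) 1+D≡q))
    b≡j′+q : b ≡ j′ ℕ.+ q
    b≡j′+q = ≡.trans (≡.cong (ℕ._+ D) j≡) (≡.trans (≡.sym (ℕ.+-suc j′ D)) (≡.cong (j′ ℕ.+_) 1+D≡q))
    e′<D : e′ ℕ.< D
    e′<D = ℕ.<-trans (≡.subst (e′ ℕ.<_) (≡.sym e≡) (ℕ.n<1+n e′)) (ℕ.s≤s e≤q-2)
    D<q : D ℕ.< q
    D<q = ≡.subst (D ℕ.<_) 1+D≡q (ℕ.n<1+n D)
    α≈Y : α ≈ Y
    α≈Y = trans (reflexive (≡.trans α≡ (≡.cong (λ n → fromℕ (n C j)) D+e≡q+e′))) (binomial-q+-low e′ j j<q)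
    β≈±X : β ≈ sign b * X
    β≈±X = begin
      β                                                           ≈⟨ β≈ ⟩
      fromℕ ((D ℕ.+ e) C D) + sign b * fromℕ ((D ℕ.+ e) C b)
        ≡⟨ ≡.cong (λ n → fromℕ (n C D) + sign b * fromℕ (n C b)) D+e≡q+e′ ⟩
      fromℕ ((q ℕ.+ e′) C D) + sign b * fromℕ ((q ℕ.+ e′) C b)
        ≈⟨ +-cong (binomial-q+-low e′ D D<q) (*-congˡ (binomial-q+-high e′ b (ℕ.<-≤-trans e′<D (ℕ.m≤n+m D j)) q≤b)) ⟩
      fromℕ (e′ C D) + sign b * fromℕ (e′ C (b ∸ q))
        ≡⟨ ≡.cong₂ (λ m n → fromℕ m + sign b * fromℕ (e′ C n)) (k>n⇒nCk≡0 e′<D) b∸q≡j′ ⟩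
      0# + sign b * X                                             ≈⟨ +-identityˡ _ ⟩
      sign b * X                                                  ∎
      where
      q≤b : q ℕ.≤ b
      q≤b = ≡.subst (q ℕ.≤_) (≡.sym b≡j′+q) (ℕ.m≤n+m q j′)
      b∸q≡j′ : b ∸ q ≡ j′
      b∸q≡j′ = ≡.trans (≡.cong (_∸ q) b≡j′+q) (ℕ.m+n∸n≡m j′ q)
    γ≈±[X+Y] : γ ≈ sign j * (X + Y)
    γ≈±[X+Y] = trans γ≈ (*-congˡ (trans (fromℕ-cong eCj≡) (fromℕ-+ (e′ C j′) (e′ C j))))
      where
      eCj≡ : e C j ≡ e′ C j′ ℕ.+ e′ C j
      eCj≡ = ≡.trans (≡.cong₂ _C_ e≡ j≡) (≡.trans (≡.sym (nCk+nC[k+1]≡[n+1]C[k+1] e′ j′)) (≡.cong (λ i → e′ C j′ ℕ.+ e′ C i) (≡.sym j≡)))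
    γ≈±Y : X ≈ 0# → γ ≈ sign j * Y
    γ≈±Y X≈0 = trans γ≈±[X+Y] (*-congˡ (trans (+-congʳ X≈0) (+-identityˡ Y)))
    γ≈±X : Y ≈ 0# → γ ≈ sign j * X
    γ≈±X Y≈0 = trans γ≈±[X+Y] (*-congˡ (trans (+-congˡ Y≈0) (+-identityʳ X)))
    ±-nonzero : ∀ a {n} → ¬ p ∣ n → ¬ sign a * fromℕ n ≈ 0#
    ±-nonzero a p∤n = *-nonzero (sign-nonzero a) (p∤⇒fromℕ≉0 p∤n)
    ±-zero : ∀ a {n} → p ∣ n → sign a * fromℕ n ≈ 0#
    ±-zero a p∣n = trans (*-congˡ (p∣⇒fromℕ≈0 p∣n)) (zeroʳ _)

    decide : Dec (p ∣ e′ C j′) → Dec (p ∣ e′ C j) → Diagonalizable M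
    decide (no p∤X) (no p∤Y) = α-case (nonzero-resp α≈Y (p∤⇒fromℕ≉0 p∤Y)) (inj₁ (nonzero-resp β≈±X (±-nonzero b p∤X)))
    decide (yes p∣X) (no p∤Y) = α-case (nonzero-resp α≈Y (p∤⇒fromℕ≉0 p∤Y)) (inj₂ (nonzero-resp (γ≈±Y (p∣⇒fromℕ≈0 p∣X)) (±-nonzero j p∤Y)))
    decide (no p∤X) (yes p∣Y) = βγ-case (nonzero-resp β≈±X (±-nonzero b p∤X)) (nonzero-resp (γ≈±X (p∣⇒fromℕ≈0 p∣Y)) (±-nonzero j p∤X))
    decide (yes p∣X) (yes p∣Y) = diagonal-case (trans β≈±X (±-zero b p∣X)) (trans (γ≈±X (p∣⇒fromℕ≈0 p∣Y)) (±-zero j p∣X))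

  diagonalizable : Diagonalizable M
  diagonalizable = cases j ≡.refl e ≡.refl
    where
    cases : ∀ j₀ → j ≡ j₀ → ∀ e₀ → e ≡ e₀ → Diagonalizable M
    cases zero j≡0 _ _ = case-j≡0 j≡0
    cases (suc _) j≡ zero e≡0 = case-e≡0 j≡ e≡0
    cases (suc _) j≡ (suc _) e≡ = case-generic j≡ e≡

open import Data.Nat using (ℕ; _^_; _∸_; _+_; _<_; _≤_)
open import Data.Nat.Primality using (Prime)
open import Data.List using (length)
open import Relation.Binary.PropositionalEquality using (_≡_; _≢_)

theorem4p3 : ∀ {c ℓ : Level} (K : Field c ℓ) → FieldOps.AlgClosed K →
    (p r : ℕ) → Prime p → p ≢ 2 → 1 ≤ r → FieldOps.HasChar K p →
    (t : Field.Carrier K) → FieldOps.Transcendental K t →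
    (k j : ℕ) → p ^ r + 3 < k → j ≤ p ^ r ∸ 2 →
    length (Cls (p ^ r) k j) ≡ 2 →
    FieldOps.Diagonalizable K (Mj K t (p ^ r) k j)
-- C_j = [j, j + q - 1] with k - 2 = j + q - 1 + e, e ≤ q - 2; then M_j is the
-- matrix of TwoElementClass.
theorem4p3 K closed p r p-prime p≢2 1≤r charK t transcendental k j _ j≤q-2 |Cⱼ|≡2
  with ResidueClass.twoMembers (p ^ r ∸ 2) j j≤q-2 (k ∸ 1) |Cⱼ|≡2
... | e , e≤q-2 , k-1≡ , Cⱼ≡[j,b] =
  AtkinCoefficients.classMatrix-cong K t k Cⱼ≡[j,b]
    (TwoElementClass.diagonalizable K closed p p-prime p≢2 charK r 1≤r t transcendental k j e j≤q-2 e≤q-2 k-1≡)
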